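{- Let $k\ge 1$ be an integer. Let $l_i=(k+i,k-i)$ for $1\le i\le k$ and $r_j=(j-1,2k-j)$ for $1\le j\le k$. Then $l_i\in L$ and $r_j\in R$, the elements $l_1,\dots,l_k$ are exactly the minimal elements of $L$, and $r_1,\dots,r_k$ are exactly the minimal elements of $R$.
   Context: $\mathbb{N}$ denotes the non-negative integers. Let $F=(2k+1)(2k+3)-(2k+1)-(2k+3)$ and $P'=\{(a,b)\in\mathbb{N}^2 \mid (2k+1)a+(2k+3)b\le F\}$, with partial order $(a_1,b_1)\le(a_0,b_0)$ iff $a_0\le a_1$ and $b_0\le b_1$. Let $L=\{(a,b)\in P' \mid a>b,\ a+b\le 2k\}$ and $R=\{(a,b)\in P' \mid a\le b,\ a+b\le 2k-1\}$, each with the induced partial order. -}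

module Defs where

open import Data.Nat using (ℕ; suc; _+_; _*_; _∸_; _≤_; _<_)
open import Data.Product using (_×_; _,_; ∃)
open import Relation.Binary.PropositionalEquality using (_≡_)

Point : Set
Point = ℕ × ℕ

F : ℕ → ℕ
F k = (2 * k + 1) * (2 * k + 3) ∸ (2 * k + 1) ∸ (2 * k + 3)

InP' : ℕ → Point → Set
InP' k (a , b) = (2 * k + 1) * a + (2 * k + 3) * b ≤ F k

_≼_ : Point → Point → Set
(a₁ , b₁) ≼ (a₀ , b₀) = (a₀ ≤ a₁) × (b₀ ≤ b₁)

InL : ℕ → Point → Set
InL k (a , b) = InP' k (a , b) × (b < a) × (a + b ≤ 2 * k)

InR : ℕ → Point → Set
InR k (a , b) = InP' k (a , b) × (a ≤ b) × (a + b ≤ 2 * k ∸ 1)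

Minimal : (Point → Set) → Point → Set
Minimal S p = S p × (∀ q → S q → q ≼ p → q ≡ p)

lpt : ℕ → ℕ → Point
lpt k i = (k + i , k ∸ i)

rpt : ℕ → ℕ → Point
rpt k j = (j ∸ 1 , 2 * k ∸ j)

-- Write k = m + 1.  The inequality defining P' reads (2k+1)(a+b) + 2b ≤ F k = 4k² + 4k − 1,
-- and the other constraints of L (b < a, a + b ≤ 2k) and of R (a + b ≤ 2k − 1) already force
-- it, so L and R are the lattice points of two triangles.  In the order ≼, which reverses the
-- coordinatewise order, a point is minimal in such a triangle exactly when it lies on the
-- hypotenuse a + b = 2k resp. a + b = 2k − 1: below it one coordinate can still be increased,
-- and on it no point dominates another.  Parametrising the hypotenuses gives the l_i and r_j.
module Submission where

open import Defs
open import Data.Nat using (ℕ; suc; _+_; _*_; _∸_; _≤_; _<_; s≤s; z≤n; s≤s⁻¹)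
open import Data.Nat.Properties
open import Data.Nat.Tactic.RingSolver using (solve-∀)
open import Data.Product using (_×_; _,_; ∃; proj₁; proj₂)
open import Data.Sum using (inj₁; inj₂)
open import Function.Base using (_∘_)
open import Function.Bundles using (_⇔_; mk⇔)
open import Relation.Binary.PropositionalEquality
open import Relation.Nullary using (contradiction)

sum : Point → ℕ
sum (a , b) = a + b

≼∧sum≤⇒≡ : ∀ {p q} → q ≼ p → sum q ≤ sum p → q ≡ p
≼∧sum≤⇒≡ {a₀ , b₀} {a₁ , b₁} (a₀≤a₁ , b₀≤b₁) sum≤ = cong₂ _,_
  (≤-antisym (+-cancelʳ-≤ b₀ a₁ a₀ (≤-trans (+-monoʳ-≤ a₁ b₀≤b₁) sum≤)) a₀≤a₁)
  (≤-antisym (+-cancelˡ-≤ a₀ b₁ b₀ (≤-trans (+-monoˡ-≤ b₁ a₀≤a₁) sum≤)) b₀≤b₁)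

sum≡bound⇒Minimal : ∀ {S : Point → Set} {n p} →
  (∀ {q} → S q → sum q ≤ n) → S p → sum p ≡ n → Minimal S p
sum≡bound⇒Minimal bounded Sp sum≡n =
  Sp , λ q Sq q≼p → ≼∧sum≤⇒≡ q≼p (≤-trans (bounded Sq) (≤-reflexive (sym sum≡n)))

2*n≡n+n : ∀ n → 2 * n ≡ n + n
2*n≡n+n n = cong (n +_) (+-identityʳ n)

2*suc∸1≡suc[2*] : ∀ n → 2 * suc n ∸ 1 ≡ suc (2 * n)
2*suc∸1≡suc[2*] n = +-suc n (n + 0)

m+m<n+n⇒m<n : ∀ {m n} → m + m < n + n → m < n
m+m<n+n⇒m<n m+m<n+n = ≰⇒> λ n≤m → <⇒≱ m+m<n+n (+-mono-≤ n≤m n≤m)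

m+n≡o⇒n≡o∸m : ∀ {m n o} → m + n ≡ o → n ≡ o ∸ m
m+n≡o⇒n≡o∸m {m} {n} refl = sym (m+n∸m≡n m n)

F-suc : ∀ m → F (suc m) ≡ (2 * suc m + 1) * (2 * suc m) + 2 * m + 1
F-suc m = begin
  F (suc m)                 ≡⟨ cong (λ x → x ∸ u ∸ v) (expand m) ⟩
  X + v + u ∸ u ∸ v         ≡⟨ cong (_∸ v) (m+n∸n≡m (X + v) u) ⟩
  X + v ∸ v                 ≡⟨ m+n∸n≡m X v ⟩
  X                         ∎
  where
  open ≡-Reasoning
  u = 2 * suc m + 1
  v = 2 * suc m + 3
  X = (2 * suc m + 1) * (2 * suc m) + 2 * m + 1
  expand : ∀ m → (2 * suc m + 1) * (2 * suc m + 3)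
               ≡ (2 * suc m + 1) * (2 * suc m) + 2 * m + 1 + (2 * suc m + 3) + (2 * suc m + 1)
  expand = solve-∀

InP'-intro : ∀ k {a b} s t → a + b ≤ s → b ≤ t →
  (2 * k + 1) * s + 2 * t ≤ F k → InP' k (a , b)
InP'-intro k {a} {b} s t a+b≤s b≤t bound = begin
  (2 * k + 1) * a + (2 * k + 3) * b  ≡⟨ regroup k a b ⟩
  (2 * k + 1) * (a + b) + 2 * b      ≤⟨ +-mono-≤ (*-monoʳ-≤ (2 * k + 1) a+b≤s)
                                                 (*-monoʳ-≤ 2 b≤t) ⟩
  (2 * k + 1) * s + 2 * t            ≤⟨ bound ⟩
  F k                                ∎
  where
  open ≤-Reasoning
  regroup : ∀ k a b → (2 * k + 1) * a + (2 * k + 3) * b ≡ (2 * k + 1) * (a + b) + 2 * b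
  regroup = solve-∀

InP'-L : ∀ m {a b} → b ≤ m → a + b ≤ 2 * suc m → InP' (suc m) (a , b)
InP'-L m b≤m a+b≤2k = InP'-intro (suc m) (2 * suc m) m a+b≤2k b≤m
  (≤-trans (m≤m+n _ 1) (≤-reflexive (sym (F-suc m))))

InP'-R : ∀ m {a b} → a + b ≤ 2 * suc m ∸ 1 → InP' (suc m) (a , b)
InP'-R m {a} {b} a+b≤2k-1 = InP'-intro (suc m) n n a+b≤n (≤-trans (m≤n+m b a) a+b≤n)
  (≤-trans (m≤m+n _ 2) (≤-reflexive (trans (bound m) (sym (F-suc m)))))
  where
  n = suc (2 * m)
  a+b≤n = ≤-trans a+b≤2k-1 (≤-reflexive (2*suc∸1≡suc[2*] m))
  bound : ∀ m → (2 * suc m + 1) * suc (2 * m) + 2 * suc (2 * m) + 2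
              ≡ (2 * suc m + 1) * (2 * suc m) + 2 * m + 1
  bound = solve-∀

InL-intro : ∀ m {a b} → b < a → a + b ≤ 2 * suc m → InL (suc m) (a , b)
InL-intro m {a} {b} b<a a+b≤2k = InP'-L m b≤m a+b≤2k , b<a , a+b≤2k
  where
  b≤m : b ≤ m
  b≤m = s≤s⁻¹ (m+m<n+n⇒m<n (begin-strict
    b + b       <⟨ +-monoˡ-< b b<a ⟩
    a + b       ≤⟨ a+b≤2k ⟩
    2 * suc m   ≡⟨ 2*n≡n+n (suc m) ⟩
    suc m + suc m ∎))
    where open ≤-Reasoning

InR-intro : ∀ m {a b} → a ≤ b → a + b ≤ 2 * suc m ∸ 1 → InR (suc m) (a , b)
InR-intro m {a} {b} a≤b a+b≤2k-1 = InP'-R m {a} {b} a+b≤2k-1 , a≤b , a+b≤2k-1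

lpt-sum : ∀ {k i} → i ≤ k → sum (lpt k i) ≡ 2 * k
lpt-sum {k} {i} i≤k = begin
  k + i + (k ∸ i)    ≡⟨ +-assoc k i (k ∸ i) ⟩
  k + (i + (k ∸ i))  ≡⟨ cong (k +_) (m+[n∸m]≡n i≤k) ⟩
  k + k              ≡⟨ 2*n≡n+n k ⟨
  2 * k              ∎
  where open ≡-Reasoning

rpt-sum : ∀ {m a} → a ≤ m → sum (rpt (suc m) (suc a)) ≡ 2 * suc m ∸ 1
rpt-sum {m} {a} a≤m = m+[n∸m]≡n (≤-trans a≤m (m≤m+n m _))

lpt∈L : ∀ m i → 1 ≤ i → i ≤ suc m → InL (suc m) (lpt (suc m) i)
lpt∈L m i 1≤i i≤k =
  InL-intro m (≤-<-trans (m∸n≤m (suc m) i) (m<m+n (suc m) 1≤i)) (≤-reflexive (lpt-sum i≤k))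

rpt∈R : ∀ m j → 1 ≤ j → j ≤ suc m → InR (suc m) (rpt (suc m) j)
rpt∈R m (suc a) _ a<k = InR-intro m (m+n≤o⇒m≤o∸n a a+a≤2k-1) (≤-reflexive (rpt-sum a≤m))
  where
  a≤m = s≤s⁻¹ a<k
  a+a≤2k-1 : a + a ≤ 2 * suc m ∸ 1
  a+a≤2k-1 = begin
    a + a          ≤⟨ +-mono-≤ a≤m a≤m ⟩
    m + m          ≡⟨ 2*n≡n+n m ⟨
    2 * m          ≤⟨ n≤1+n (2 * m) ⟩
    suc (2 * m)    ≡⟨ 2*suc∸1≡suc[2*] m ⟨
    2 * suc m ∸ 1  ∎
    where open ≤-Reasoning

Minimal-InL⇒sum≡ : ∀ m {p} → Minimal (InL (suc m)) p → sum p ≡ 2 * suc m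
Minimal-InL⇒sum≡ m {a , b} ((_ , b<a , a+b≤2k) , minimal) with m≤n⇒m<n∨m≡n a+b≤2k
... | inj₂ a+b≡2k = a+b≡2k
... | inj₁ a+b<2k =
  contradiction (cong proj₁ (minimal (suc a , b) right-neighbour (n≤1+n a , ≤-refl))) 1+n≢n
  where
  right-neighbour : InL (suc m) (suc a , b)
  right-neighbour = InL-intro m (m<n⇒m<1+n b<a) a+b<2k

Minimal-InR⇒sum≡ : ∀ m {p} → Minimal (InR (suc m)) p → sum p ≡ 2 * suc m ∸ 1
Minimal-InR⇒sum≡ m {a , b} ((_ , a≤b , a+b≤2k-1) , minimal) with m≤n⇒m<n∨m≡n a+b≤2k-1
... | inj₂ a+b≡2k-1 = a+b≡2k-1
... | inj₁ a+b<2k-1 =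
  contradiction (cong proj₂ (minimal (a , suc b) upper-neighbour (≤-refl , n≤1+n b))) 1+n≢n
  where
  upper-neighbour : InR (suc m) (a , suc b)
  upper-neighbour =
    InR-intro m (m≤n⇒m≤1+n a≤b) (subst (_≤ 2 * suc m ∸ 1) (sym (+-suc a b)) a+b<2k-1)

on-hypotenuse-L : ∀ {k a b} → b < a → a + b ≡ 2 * k →
  ∃ λ i → (1 ≤ i) × (i ≤ k) × ((a , b) ≡ lpt k i)
on-hypotenuse-L {k} {a} {b} b<a a+b≡2k =
  a ∸ k , m<n⇒0<n∸m k<a , i≤k , cong₂ _,_ a≡k+i (m+n≡o⇒n≡o∸m i+b≡k)
  where
  a+b≡k+k = trans a+b≡2k (2*n≡n+n k)
  k<a : k < a
  k<a = ≰⇒> λ a≤k → <-irrefl a+b≡k+k (begin-strict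
    a + b  <⟨ +-monoʳ-< a b<a ⟩
    a + a  ≤⟨ +-mono-≤ a≤k a≤k ⟩
    k + k  ∎)
    where open ≤-Reasoning
  a≡k+i : a ≡ k + (a ∸ k)
  a≡k+i = sym (m+[n∸m]≡n (<⇒≤ k<a))
  i+b≡k : a ∸ k + b ≡ k
  i+b≡k = +-cancelˡ-≡ k _ _ (begin
    k + (a ∸ k + b)  ≡⟨ +-assoc k (a ∸ k) b ⟨
    k + (a ∸ k) + b  ≡⟨ cong (_+ b) a≡k+i ⟨
    a + b            ≡⟨ a+b≡k+k ⟩
    k + k            ∎)
    where open ≡-Reasoning
  i≤k : a ∸ k ≤ k
  i≤k = ≤-trans (m≤m+n (a ∸ k) b) (≤-reflexive i+b≡k)

on-hypotenuse-R : ∀ {m a b} → a ≤ b → a + b ≡ 2 * suc m ∸ 1 →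
  ∃ λ j → (1 ≤ j) × (j ≤ suc m) × ((a , b) ≡ rpt (suc m) j)
on-hypotenuse-R {m} {a} {b} a≤b a+b≡2k-1 =
  suc a , s≤s z≤n , a<k , cong (a ,_) (m+n≡o⇒n≡o∸m a+b≡2k-1)
  where
  a<k : a < suc m
  a<k = m+m<n+n⇒m<n (begin-strict
    a + a          ≤⟨ +-monoʳ-≤ a a≤b ⟩
    a + b          ≡⟨ a+b≡2k-1 ⟩
    2 * suc m ∸ 1  <⟨ n<1+n (2 * suc m ∸ 1) ⟩
    2 * suc m      ≡⟨ 2*n≡n+n (suc m) ⟩
    suc m + suc m  ∎)
    where open ≤-Reasoning

Minimal-InL⇔lpt : ∀ m p →
  Minimal (InL (suc m)) p ⇔ ∃ λ i → (1 ≤ i) × (i ≤ suc m) × (p ≡ lpt (suc m) i)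
Minimal-InL⇔lpt m p = mk⇔
  (λ { min@((_ , b<a , _) , _) → on-hypotenuse-L b<a (Minimal-InL⇒sum≡ m min) })
  (λ { (i , 1≤i , i≤k , refl) →
         sum≡bound⇒Minimal (proj₂ ∘ proj₂) (lpt∈L m i 1≤i i≤k) (lpt-sum i≤k) })

Minimal-InR⇔rpt : ∀ m p →
  Minimal (InR (suc m)) p ⇔ ∃ λ j → (1 ≤ j) × (j ≤ suc m) × (p ≡ rpt (suc m) j)
Minimal-InR⇔rpt m p = mk⇔
  (λ { min@((_ , a≤b , _) , _) → on-hypotenuse-R a≤b (Minimal-InR⇒sum≡ m min) })
  (λ { (suc a , 1≤j , j≤k , refl) →
         sum≡bound⇒Minimal (proj₂ ∘ proj₂) (rpt∈R m (suc a) 1≤j j≤k)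
                           (rpt-sum (s≤s⁻¹ j≤k)) })

lemma3p5 : (k : ℕ) → 1 ≤ k →
    ((i : ℕ) → 1 ≤ i → i ≤ k → InL k (lpt k i))
    × ((j : ℕ) → 1 ≤ j → j ≤ k → InR k (rpt k j))
    × ((p : Point) → Minimal (InL k) p ⇔ ∃ (λ i → (1 ≤ i) × (i ≤ k) × (p ≡ lpt k i)))
    × ((p : Point) → Minimal (InR k) p ⇔ ∃ (λ j → (1 ≤ j) × (j ≤ k) × (p ≡ rpt k j)))
lemma3p5 (suc m) _ = lpt∈L m , rpt∈R m , Minimal-InL⇔lpt m , Minimal-InR⇔rpt m
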